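{- For $X\neq Y\subseteq\mathbb{N}$ we have $\mathbf{HSP}(\mathfrak{C}_X)\neq\mathbf{HSP}(\mathfrak{C}_Y)$. In particular, there are continuum many subadditive varieties of Boolean frames lacking the congruence extension property.
   Context: A Boolean frame is an algebra $\langle A,\sqcap,-,0,f\rangle$ with $\langle A,\sqcap,-,0\rangle$ a Boolean algebra and $f:A\to A$ an arbitrary unary operation; it is subadditive if $f(x\sqcup y)\le f(x)\sqcup f(y)$ for all $x,y$. An algebra has the congruence extension property (CEP) if for every subalgebra $B$ and every congruence $\Theta$ of $B$ there is a congruence $\Psi$ of the algebra with $\Psi\cap(B\times B)=\Theta$; a variety lacks CEP if some member lacks it. $\mathbf{HSP}(\mathfrak{C})$ is the variety generated by $\mathfrak{C}$. Let $E=\{2n:n\in\mathbb{N}\}$, $O=\{2n+1:n\in\mathbb{N}\}$, and let $E^*$ be the set of infinite $S\subseteq\mathbb{N}$ such that $S\cap O$ is finite and $E\setminus S$ is finite. For $n\in\mathbb{N}$ write $\overline{n}=\{n\}$ and $-\overline{n}=\mathbb{N}\setminus\{n\}$. For $X\subseteq\mathbb{N}$, $\mathfrak{C}_X=\langle\mathcal{P}(\mathbb{N}),g\rangle$ is the powerset Boolean algebra of $\mathbb{N}$ with $g$ defined for $S\subseteq\mathbb{N}$ by: $g(S)=\{0,\dots,n\}$ if $S=\{0,\dots,n-1\}$ for some $n\in\mathbb{N}$; $g(S)=S$ if $S\in E^*$; $g(S)=-\overline{n}$ if $S=-\overline{n}$ and $n\in X$; $g(S)=S\cup\{\max(S)+1\}$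 if $S$ is finite and $S\neq\{0,\dots,n-1\}$ for all $n\in\mathbb{N}$; and $g(S)=\mathbb{N}$ otherwise. -}

module Defs where

open import Data.Nat using (ℕ; zero; suc; _<ᵇ_; _≡ᵇ_; _≤_; _%_)
open import Data.Bool using (Bool; true; false; not; _∧_; _∨_)
open import Data.Product using (Σ; _×_; _,_)
open import Relation.Nullary using (¬_; Dec; yes; no)
open import Relation.Binary.PropositionalEquality using (_≡_)
open import Relation.Binary.Structures using (IsEquivalence)
open import Algebra.Lattice.Structures using (IsBooleanAlgebra)

record RawBF : Set₁ where
  infixr 7 _⊓_
  field
    Carrier : Set
    _≈_     : Carrier → Carrier → Set
    _⊓_     : Carrier → Carrier → Carrier
    -_      : Carrier → Carrier
    𝟘       : Carrier
    f       : Carrier → Carrier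

  _⊔_ : Carrier → Carrier → Carrier
  x ⊔ y = - ((- x) ⊓ (- y))

  𝟙 : Carrier
  𝟙 = - 𝟘

  _≼_ : Carrier → Carrier → Set
  x ≼ y = (x ⊓ y) ≈ x

record BF : Set₁ where
  field
    raw   : RawBF
  open RawBF raw public
  field
    isBA   : IsBooleanAlgebra _≈_ _⊔_ _⊓_ -_ 𝟙 𝟘
    f-cong : ∀ {x y} → x ≈ y → f x ≈ f y

open BF using (raw)

Subadditive : BF → Set
Subadditive A = ∀ x y → f (x ⊔ y) ≼ (f x ⊔ f y)
  where open BF A

record Hom (A B : RawBF) : Set where
  private
    module A = RawBF A
    module B = RawBF B
  field
    ⟦_⟧   : A.Carrier → B.Carrier
    cong  : ∀ {x y} → x A.≈ y → ⟦ x ⟧ B.≈ ⟦ y ⟧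
    pres-⊓ : ∀ x y → ⟦ x A.⊓ y ⟧ B.≈ (⟦ x ⟧ B.⊓ ⟦ y ⟧)
    pres-neg : ∀ x → ⟦ A.- x ⟧ B.≈ (B.- ⟦ x ⟧)
    pres-𝟘 : ⟦ A.𝟘 ⟧ B.≈ B.𝟘
    pres-f : ∀ x → ⟦ A.f x ⟧ B.≈ B.f ⟦ x ⟧

open Hom public

Injective : ∀ {A B} → Hom A B → Set
Injective {A} {B} h = ∀ x y → RawBF._≈_ B (⟦ h ⟧ x) (⟦ h ⟧ y) → RawBF._≈_ A x y

Surjective : ∀ {A B} → Hom A B → Set
Surjective {A} {B} h = ∀ b → Σ (RawBF.Carrier A) λ a → RawBF._≈_ B (⟦ h ⟧ a) b

-- A family of homomorphisms e i : A → C (i ∈ I) that is jointly injective,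
-- i.e. the induced map A → C^I is an embedding (A is, up to
-- isomorphism, a subalgebra of the power C^I).
EmbedsInPower : (I : Set) → RawBF → RawBF → Set
EmbedsInPower I A C =
  Σ (I → Hom A C) λ e →
    ∀ x y → (∀ i → RawBF._≈_ C (⟦ e i ⟧ x) (⟦ e i ⟧ y)) → RawBF._≈_ A x y

HSP : RawBF → BF → Set₁
HSP C B =
  Σ Set λ I →
  Σ BF λ A →
    EmbedsInPower I (raw A) C ×
    Σ (Hom (raw A) (raw B)) Surjective

record Congruence (A : BF) : Set₁ where
  open BF A
  field
    Θ       : Carrier → Carrier → Set
    isEquiv : IsEquivalence Θ
    ≈⊆Θ     : ∀ {x y} → x ≈ y → Θ x y
    ⊓-comp  : ∀ {x x' y y'} → Θ x x' → Θ y y' → Θ (x ⊓ y) (x' ⊓ y')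
    neg-comp : ∀ {x x'} → Θ x x' → Θ (- x) (- x')
    f-comp  : ∀ {x x'} → Θ x x' → Θ (f x) (f x')

CEP : BF → Set₁
CEP A =
  (B : BF) (e : Hom (raw B) (raw A)) → Injective e →
  (Θ : Congruence B) →
  Σ (Congruence A) λ Ψ →
    ∀ x y → (Congruence.Θ Ψ (⟦ e ⟧ x) (⟦ e ⟧ y) → Congruence.Θ Θ x y)
          × (Congruence.Θ Θ x y → Congruence.Θ Ψ (⟦ e ⟧ x) (⟦ e ⟧ y))

-- Since g is defined by a classical case distinction
-- (finiteness etc. are undecidable), it is defined relative to an
-- excluded-middle oracle.

LEM : Set₁
LEM = (P : Set) → Dec P

Subset : Set
Subset = ℕ → Bool

_≐_ : Subset → Subset → Set
S ≐ T = ∀ k → S k ≡ T k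

initSeg : ℕ → Subset
initSeg n k = k <ᵇ n

coSingleton : ℕ → Subset
coSingleton n k = not (k ≡ᵇ n)

isEven : ℕ → Bool
isEven k = k % 2 ≡ᵇ 0

Finite : Subset → Set
Finite S = Σ ℕ λ N → ∀ k → N ≤ k → S k ≡ false

Infinite : Subset → Set
Infinite S = ¬ Finite S

EStar : Subset → Set
EStar S = Infinite S
        × Finite (λ k → not (isEven k) ∧ S k)
        × Finite (λ k → isEven k ∧ not (S k))

-- largest k < N with S k (0 if none); for finite nonempty S bounded by
-- N this is max(S)
maxBelow : ℕ → Subset → ℕ
maxBelow zero    S = 0
maxBelow (suc N) S with S N
... | true  = N
... | false = maxBelow N S

g : LEM → Subset → Subset → Subset
g lem X S with lem (Σ ℕ λ n → S ≐ initSeg n)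
... | yes (n , _) = initSeg (suc n)
... | no _ with lem (EStar S)
...   | yes _ = S
...   | no _ with lem (Σ ℕ λ n → (S ≐ coSingleton n) × (X n ≡ true))
...     | yes (n , _) = coSingleton n
...     | no _ with lem (Finite S)
...       | yes (N , _) = λ k → S k ∨ (k ≡ᵇ suc (maxBelow N S))
...       | no _ = λ _ → true

𝔠 : LEM → Subset → RawBF
𝔠 lem X = record
  { Carrier = Subset
  ; _≈_     = _≐_
  ; _⊓_     = λ S T k → S k ∧ T k
  ; -_      = λ S k → not (S k)
  ; 𝟘       = λ _ → false
  ; f       = g lem X
  }

SameClass : (BF → Set₁) → (BF → Set₁) → Set₁
SameClass K L = ∀ B → (K B → L B) × (L B → K B)

{-# OPTIONS --safe #-}
-- Since g sends {0,…,n−1} to {0,…,n}, the term coSingletonₜ n = −(fⁿ⁺¹0 ⊓ −fⁿ0) denotes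
-- ℕ ∖ {n} in every 𝔠_X, so the identity f(coSingletonₜ n) ≈ 1 holds in 𝔠_X exactly when
-- n ∉ X. Identities of 𝔠_X hold throughout HSP(𝔠_X), so this separates the varieties.
-- Subadditivity is an identity as well. In 𝔠_X a point of g(S ∪ T) outside S ∪ T is either
-- the successor of max(S ∪ T) (or 0 if S ∪ T = ∅), which g S or g T also contains, or it
-- comes from g(S ∪ T) = ℕ; but if it is missing from g S and g T, then S and T are each
-- finite, in E* or of the form ℕ ∖ {n} with n ∈ X, so S ∪ T is too and g(S ∪ T) ≠ ℕ.
-- CEP fails in 𝔠_X itself. The sets that eventually agree with ∅, E, O or ℕ form a
-- subalgebra D on which g never changes the eventual behaviour on the odd numbers, so
-- having the same such behaviour is a congruence of D; it relates E to ∅. An extension to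
-- 𝔠_X must then relate the multiples of 4 to ∅, hence g of them, which is ℕ, to g ∅ = {0};
-- as {0} is related to ∅ in D, it relates ℕ to ∅, which differ on the odds.
module Submission where

open import Defs hiding (cong)
open import Level using (0ℓ)
open import Algebra.Lattice using (IsBooleanAlgebra; isBooleanAlgebraʳ; isDistributiveLatticeʳʲᵐ)
open import Data.Bool using (Bool; true; false; not; _∧_; _∨_; if_then_else_)
import Data.Bool.Properties as Boolₚ
open import Data.Empty using (⊥; ⊥-elim)
open import Data.Nat using (ℕ; zero; suc; _*_; _/_; _≤_; _<_; _⊔_; _≟_; _≡ᵇ_; z≤n; s≤s)
open import Data.Nat.Properties
  using (≤-refl; ≤-trans; <-cmp; m≤m⊔n; m≤n⊔m; m≤m*n; m≤n⇒m≤1+n; m≤n⇒m<n∨m≡n; >⇒≢;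
         <ᵇ⇒<; ≡ᵇ⇒≡; ≡⇒≡ᵇ)
open import Data.Nat.DivMod using (m*n%n≡0; [m+kn]%n≡m%n; m*n/n≡m)
open import Data.Product using (Σ; _×_; _,_; proj₁; proj₂)
open import Data.Sum using (_⊎_; inj₁; inj₂; [_,_])
open import Data.Unit using (⊤; tt)
open import Function using (_∘_; Equivalence)
open import Relation.Binary using (Setoid; IsEquivalence; tri<; tri≈; tri>)
import Relation.Binary.Construct.On as On
import Relation.Binary.Reasoning.Setoid as ≈-Reasoning
open import Relation.Binary.PropositionalEquality
  using (_≡_; _≢_; refl; sym; trans; cong; cong₂; module ≡-Reasoning)
  renaming (isEquivalence to ≡-isEquivalence)
open import Relation.Nullary using (¬_; yes; no)

open BF using (raw)

private
  variable
    V : Set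
    a b : Bool
    k m n M : ℕ
    S T : Subset
    P Q : ℕ → Set

-- Identities and the variety HSP(C)

BF-setoid : BF → Setoid 0ℓ 0ℓ
BF-setoid A = record { isEquivalence = IsBooleanAlgebra.isEquivalence (BF.isBA A) }

idHom : (A : BF) → Hom (raw A) (raw A)
idHom A = record
  { ⟦_⟧ = λ x → x ; cong = λ x≈y → x≈y ; pres-⊓ = λ _ _ → ≈-refl ; pres-neg = λ _ → ≈-refl
  ; pres-𝟘 = ≈-refl ; pres-f = λ _ → ≈-refl }
  where open Setoid (BF-setoid A) using () renaming (refl to ≈-refl)

HSP-self : (C : BF) → HSP (raw C) C
HSP-self C =
  ⊤ , C , ((λ _ → idHom C) , λ _ _ x≈y → x≈y tt) , idHom C , λ x → x , Setoid.refl (BF-setoid C)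

infixr 7 _⊓ₜ_
data Term (V : Set) : Set where
  var  : V → Term V
  _⊓ₜ_ : Term V → Term V → Term V
  -ₜ_  : Term V → Term V
  𝟘ₜ   : Term V
  fₜ   : Term V → Term V

_⊔ₜ_ : Term V → Term V → Term V
s ⊔ₜ t = -ₜ (-ₜ s ⊓ₜ -ₜ t)

𝟙ₜ : Term V
𝟙ₜ = -ₜ 𝟘ₜ

eval : (A : RawBF) → (V → RawBF.Carrier A) → Term V → RawBF.Carrier A
eval A ρ (var v)  = ρ v
eval A ρ (s ⊓ₜ t) = RawBF._⊓_ A (eval A ρ s) (eval A ρ t)
eval A ρ (-ₜ t)   = RawBF.-_ A (eval A ρ t)
eval A ρ 𝟘ₜ       = RawBF.𝟘 A
eval A ρ (fₜ t)   = RawBF.f A (eval A ρ t)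

_⊨_≈ₜ_ : BF → Term V → Term V → Set
A ⊨ s ≈ₜ t = ∀ ρ → BF._≈_ A (eval (raw A) ρ s) (eval (raw A) ρ t)

module _ (B : BF) where
  open BF B hiding (raw)
  open IsBooleanAlgebra isBA using (∧-cong; ¬-cong) renaming (refl to ≈-refl; trans to ≈-trans)

  eval-cong : ∀ {ρ σ : V → Carrier} → (∀ v → ρ v ≈ σ v) →
              ∀ t → eval (raw B) ρ t ≈ eval (raw B) σ t
  eval-cong ρ≈σ (var v)  = ρ≈σ v
  eval-cong ρ≈σ (s ⊓ₜ t) = ∧-cong (eval-cong ρ≈σ s) (eval-cong ρ≈σ t)
  eval-cong ρ≈σ (-ₜ t)   = ¬-cong (eval-cong ρ≈σ t)
  eval-cong ρ≈σ 𝟘ₜ       = ≈-refl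
  eval-cong ρ≈σ (fₜ t)   = f-cong (eval-cong ρ≈σ t)

  eval-hom : ∀ {A} (h : Hom A (raw B)) (ρ : V → RawBF.Carrier A) t →
             ⟦ h ⟧ (eval A ρ t) ≈ eval (raw B) (⟦ h ⟧ ∘ ρ) t
  eval-hom h ρ (var v)  = ≈-refl
  eval-hom h ρ (s ⊓ₜ t) = ≈-trans (pres-⊓ h _ _) (∧-cong (eval-hom h ρ s) (eval-hom h ρ t))
  eval-hom h ρ (-ₜ t)   = ≈-trans (pres-neg h _) (¬-cong (eval-hom h ρ t))
  eval-hom h ρ 𝟘ₜ       = pres-𝟘 h
  eval-hom h ρ (fₜ t)   = ≈-trans (pres-f h _) (f-cong (eval-hom h ρ t))

⊨-subpower : ∀ {I} (C A : BF) {s t : Term V} →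
             EmbedsInPower I (raw A) (raw C) → C ⊨ s ≈ₜ t → A ⊨ s ≈ₜ t
⊨-subpower C A {s} {t} (e , jointly-injective) C⊨s≈t σ = jointly-injective _ _ λ i → begin
  ⟦ e i ⟧ (eval (raw A) σ s)  ≈⟨ eval-hom C (e i) σ s ⟩
  eval (raw C) (⟦ e i ⟧ ∘ σ) s ≈⟨ C⊨s≈t _ ⟩
  eval (raw C) (⟦ e i ⟧ ∘ σ) t ≈⟨ eval-hom C (e i) σ t ⟨
  ⟦ e i ⟧ (eval (raw A) σ t)  ∎
  where open ≈-Reasoning (BF-setoid C)

⊨-image : (A B : BF) {s t : Term V} (h : Hom (raw A) (raw B)) →
          Surjective h → A ⊨ s ≈ₜ t → B ⊨ s ≈ₜ t
⊨-image {V} A B {s} {t} h surj A⊨s≈t ρ = begin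
  eval (raw B) ρ s              ≈⟨ eval-cong B (λ v → proj₂ (surj (ρ v))) s ⟨
  eval (raw B) (⟦ h ⟧ ∘ σ) s    ≈⟨ eval-hom B h σ s ⟨
  ⟦ h ⟧ (eval (raw A) σ s)      ≈⟨ Hom.cong h (A⊨s≈t σ) ⟩
  ⟦ h ⟧ (eval (raw A) σ t)      ≈⟨ eval-hom B h σ t ⟩
  eval (raw B) (⟦ h ⟧ ∘ σ) t    ≈⟨ eval-cong B (λ v → proj₂ (surj (ρ v))) t ⟩
  eval (raw B) ρ t              ∎
  where
  open ≈-Reasoning (BF-setoid B)
  σ : V → BF.Carrier A
  σ v = proj₁ (surj (ρ v))

⊨-HSP : (C : BF) {s t : Term V} → C ⊨ s ≈ₜ t → ∀ {B} → HSP (raw C) B → B ⊨ s ≈ₜ t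
⊨-HSP C {s} {t} C⊨s≈t {B} (_ , A , embedding , h , surj) =
  ⊨-image A B {s} {t} h surj (⊨-subpower C A {s} {t} embedding C⊨s≈t)

module Subalgebra (C : BF) (P : BF.Carrier C → Set)
  (⊓-closed : ∀ {x y} → P x → P y → P (BF._⊓_ C x y))
  (-‿closed : ∀ {x} → P x → P (BF.-_ C x))
  (𝟘-closed : P (BF.𝟘 C))
  (f-closed : ∀ {x} → P x → P (BF.f C x))
  where
  private module C = BF C
  open IsBooleanAlgebra C.isBA renaming (refl to ≈-refl)

  sub : BF
  sub = record
    { raw = record
      { Carrier = Σ C.Carrier P
      ; _≈_     = λ x y → proj₁ x C.≈ proj₁ y
      ; _⊓_     = λ x y → proj₁ x C.⊓ proj₁ y , ⊓-closed (proj₂ x) (proj₂ y)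
      ; -_      = λ x → C.- proj₁ x , -‿closed (proj₂ x)
      ; 𝟘       = C.𝟘 , 𝟘-closed
      ; f       = λ x → C.f (proj₁ x) , f-closed (proj₂ x)
      }
    ; isBA = isBooleanAlgebraʳ record
      { isDistributiveLattice = isDistributiveLatticeʳʲᵐ record
        { isLattice = record
          { isEquivalence = On.isEquivalence proj₁ isEquivalence
          ; ∨-comm     = λ x y → ∨-comm (proj₁ x) (proj₁ y)
          ; ∨-assoc    = λ x y z → ∨-assoc (proj₁ x) (proj₁ y) (proj₁ z)
          ; ∨-cong     = ∨-cong
          ; ∧-comm     = λ x y → ∧-comm (proj₁ x) (proj₁ y)
          ; ∧-assoc    = λ x y z → ∧-assoc (proj₁ x) (proj₁ y) (proj₁ z)
          ; ∧-cong     = ∧-cong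
          ; absorptive = (λ x y → ∨-absorbs-∧ (proj₁ x) (proj₁ y)) ,
                         (λ x y → ∧-absorbs-∨ (proj₁ x) (proj₁ y))
          }
        ; ∨-distribʳ-∧ = λ x y z → ∨-distribʳ-∧ (proj₁ x) (proj₁ y) (proj₁ z)
        }
      ; ∨-complementʳ = λ x → ∨-complementʳ (proj₁ x)
      ; ∧-complementʳ = λ x → ∧-complementʳ (proj₁ x)
      ; ¬-cong        = ¬-cong
      }
    ; f-cong = C.f-cong
    }

  inclusion : Hom (raw sub) (raw C)
  inclusion = record
    { ⟦_⟧ = proj₁ ; cong = λ x≈y → x≈y ; pres-⊓ = λ _ _ → ≈-refl ; pres-neg = λ _ → ≈-refl
    ; pres-𝟘 = ≈-refl ; pres-f = λ _ → ≈-refl }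

  inclusion-injective : Injective inclusion
  inclusion-injective _ _ x≈y = x≈y

true≢false : true ≢ false
true≢false ()

∧-true⁻ : a ∧ b ≡ true → a ≡ true × b ≡ true
∧-true⁻ {true} b≡true = refl , b≡true

not-true⁻ : not a ≡ true → a ≡ false
not-true⁻ {false} _ = refl

-- The join −(−x ⊓ −y) of a raw Boolean frame, on Bool; it agrees with _∨_ only propositionally.
infixr 6 _∨ᵈ_
_∨ᵈ_ : Bool → Bool → Bool
a ∨ᵈ b = not (not a ∧ not b)

∨ᵈ≡∨ : ∀ a b → a ∨ᵈ b ≡ a ∨ b
∨ᵈ≡∨ true  b = refl
∨ᵈ≡∨ false b = Boolₚ.not-involutive b

∨ᵈ-true : a ≡ true ⊎ b ≡ true → a ∨ᵈ b ≡ true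
∨ᵈ-true (inj₁ refl)      = refl
∨ᵈ-true {a} (inj₂ refl) = trans (∨ᵈ≡∨ a true) (Boolₚ.∨-zeroʳ a)

∧-absorbs-implied : (a ≡ true → b ≡ true) → a ∧ b ≡ a
∧-absorbs-implied {true}  a⇒b = a⇒b refl
∧-absorbs-implied {false} _   = refl

isEven-even : ∀ m → isEven (m * 2) ≡ true
isEven-even m = cong (_≡ᵇ 0) (m*n%n≡0 m 2)

isEven-odd : ∀ m → isEven (suc (m * 2)) ≡ false
isEven-odd m = cong (_≡ᵇ 0) ([m+kn]%n≡m%n 1 m 2)

≤-*2 : ∀ m → m ≤ m * 2
≤-*2 m = m≤m*n m 2

≤-1+*2 : ∀ m → m ≤ suc (m * 2)
≤-1+*2 m = m≤n⇒m≤1+n (≤-*2 m)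

Eventually : (ℕ → Set) → Set
Eventually P = Σ ℕ λ N → ∀ k → N ≤ k → P k

eventually-mono : (∀ {k} → P k → Q k) → Eventually P → Eventually Q
eventually-mono P⇒Q (N , p) = N , λ k N≤k → P⇒Q (p k N≤k)

eventually-zip : Eventually P → Eventually Q → Eventually (λ k → P k × Q k)
eventually-zip (N , p) (M , q) =
  N ⊔ M , λ k N⊔M≤k → p k (≤-trans (m≤m⊔n N M) N⊔M≤k) , q k (≤-trans (m≤n⊔m N M) N⊔M≤k)

eventually-along : (h : ℕ → ℕ) → (∀ m → m ≤ h m) → Eventually P → Eventually (P ∘ h)
eventually-along h h-inflationary (N , p) = N , λ m N≤m → p (h m) (≤-trans N≤m (h-inflationary m))

eventually-sample : Eventually P → Σ ℕ P
eventually-sample (N , p) = N , p N ≤-refl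

∅ : Subset
∅ _ = false

univ : Subset
univ _ = true

｛_｝ : ℕ → Subset
｛ n ｝ k = k ≡ᵇ n

infixr 6 _∪_
_∪_ : Subset → Subset → Subset
(S ∪ T) k = S k ∨ T k

infix 4 _⊆_
_⊆_ : Subset → Subset → Set
S ⊆ T = ∀ {k} → S k ≡ true → T k ≡ true

oddPart : Subset → Subset
oddPart S k = not (isEven k) ∧ S k

evenGap : Subset → Subset
evenGap S k = isEven k ∧ not (S k)

InitialSegment : Subset → Set
InitialSegment S = Σ ℕ λ n → S ≐ initSeg n

IsMax : Subset → ℕ → Set
IsMax S M = S M ≡ true × (∀ {k} → M < k → S k ≡ false)

≐-isEquivalence : IsEquivalence _≐_
≐-isEquivalence = record
  { refl = λ _ → refl ; sym = λ S≐T k → sym (S≐T k) ; trans = λ S≐T T≐U k → trans (S≐T k) (T≐U k) }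

open IsEquivalence ≐-isEquivalence using () renaming (sym to ≐-sym; trans to ≐-trans)

∪-⊆ˡ : S ⊆ S ∪ T
∪-⊆ˡ S∋k rewrite S∋k = refl

∪-⊆ʳ : T ⊆ S ∪ T
∪-⊆ʳ {T} {S} {k} T∋k rewrite T∋k = Boolₚ.∨-zeroʳ (S k)

∪-∌ : (S ∪ T) k ≡ false → S k ≡ false × T k ≡ false
∪-∌ {S} {T} {k} S∪T∌k with S k
... | false = refl , S∪T∌k

∪-∈ : (S ∪ T) k ≡ true → S k ≡ true ⊎ T k ≡ true
∪-∈ {S} {T} {k} S∪T∋k with S k
... | true  = inj₁ refl
... | false = inj₂ S∪T∋k

∪-∈ʳ : (S ∪ T) k ≡ true → S k ≡ false → T k ≡ true
∪-∈ʳ S∪T∋k S∌k rewrite S∌k = S∪T∋k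

⊆-∌ : S ⊆ T → T k ≡ false → S k ≡ false
⊆-∌ {S} {T} {k} S⊆T T∌k with S k in S∋k
... | false = refl
... | true  = ⊥-elim (true≢false (trans (sym (S⊆T S∋k)) T∌k))

initSeg-∈ : k < n → initSeg n k ≡ true
initSeg-∈ {zero}  {suc n} _         = refl
initSeg-∈ {suc k} {suc n} (s≤s k<n) = initSeg-∈ k<n

initSeg-∉ : n ≤ k → initSeg n k ≡ false
initSeg-∉ z≤n       = refl
initSeg-∉ (s≤s n≤k) = initSeg-∉ n≤k

initSeg-∈⁻ : initSeg n k ≡ true → k < n
initSeg-∈⁻ {n} {k} k∈ = <ᵇ⇒< k n (Equivalence.from Boolₚ.T-≡ k∈)

initSeg-suc∖initSeg : ∀ n k → initSeg (suc n) k ∧ not (initSeg n k) ≡ ｛ n ｝ k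
initSeg-suc∖initSeg zero    zero    = refl
initSeg-suc∖initSeg zero    (suc k) = refl
initSeg-suc∖initSeg (suc n) zero    = refl
initSeg-suc∖initSeg (suc n) (suc k) = initSeg-suc∖initSeg n k

｛｝-∈ : ｛ n ｝ n ≡ true
｛｝-∈ {n} = Equivalence.to Boolₚ.T-≡ (≡⇒≡ᵇ n n refl)

｛｝-∈⁻ : ｛ n ｝ k ≡ true → k ≡ n
｛｝-∈⁻ {n} {k} k∈ = ≡ᵇ⇒≡ k n (Equivalence.from Boolₚ.T-≡ k∈)

initSeg-suc-new : ∀ n → initSeg (suc n) k ≡ true → initSeg n k ≡ false → k ≡ n
initSeg-suc-new {k} n k∈ k∉ =
  ｛｝-∈⁻ (trans (sym (initSeg-suc∖initSeg n k)) (cong₂ (λ a b → a ∧ not b) k∈ k∉))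

｛｝-∉ : k ≢ n → ｛ n ｝ k ≡ false
｛｝-∉ {k} {n} k≢n with ｛ n ｝ k in k∈
... | false = refl
... | true  = ⊥-elim (k≢n (｛｝-∈⁻ k∈))

coSingleton-∉ : coSingleton n n ≡ false
coSingleton-∉ {n} = cong not (｛｝-∈ {n})

coSingleton-∈ : k ≢ n → coSingleton n k ≡ true
coSingleton-∈ k≢n = cong not (｛｝-∉ k≢n)

coSingleton-∉⁻ : coSingleton n k ≡ false → k ≡ n
coSingleton-∉⁻ {n} {k} k∉ with ｛ n ｝ k in k∈
... | true = ｛｝-∈⁻ k∈

oddPart-odd : ∀ m → S (suc (m * 2)) ≡ true → oddPart S (suc (m * 2)) ≡ true
oddPart-odd m S∋ rewrite isEven-odd m = S∋

evenGap-even : ∀ m → S (m * 2) ≡ false → evenGap S (m * 2) ≡ true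
evenGap-even m S∌ rewrite isEven-even m | S∌ = refl

evenGap-antitone : S ⊆ T → evenGap T ⊆ evenGap S
evenGap-antitone {S} {T} S⊆T {k} T-gap =
  cong₂ _∧_ (proj₁ T-gap′) (cong not (⊆-∌ {S} {T} {k} S⊆T (not-true⁻ (proj₂ T-gap′))))
  where
  T-gap′ : isEven k ≡ true × not (T k) ≡ true
  T-gap′ = ∧-true⁻ {isEven k} T-gap

finite-≐ : S ≐ T → Finite S → Finite T
finite-≐ S≐T = eventually-mono λ {k} S∌k → trans (sym (S≐T k)) S∌k

finite-⊆ : S ⊆ T → Finite T → Finite S
finite-⊆ {S} {T} S⊆T = eventually-mono λ {k} → ⊆-∌ {S} {T} {k} S⊆T

finite-∪ : Finite S → Finite T → Finite (S ∪ T)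
finite-∪ finS finT = eventually-mono (λ { (S∌k , T∌k) → cong₂ _∨_ S∌k T∌k }) (eventually-zip finS finT)

infinite-along : (h : ℕ → ℕ) → (∀ m → m ≤ h m) → Eventually (λ m → S (h m) ≡ true) → Infinite S
infinite-along h h-inflationary S∋h finS
  with eventually-sample (eventually-zip (eventually-along h h-inflationary finS) S∋h)
... | _ , S∌ , S∋ = true≢false (trans (sym S∋) S∌)

cofinite-infinite : Eventually (λ k → S k ≡ true) → Infinite S
cofinite-infinite = infinite-along (λ m → m) (λ _ → ≤-refl)

initSeg-finite : Finite (initSeg n)
initSeg-finite {n} = n , λ k → initSeg-∉ {n} {k}

≐initSeg⇒finite : ∀ n → S ≐ initSeg n → Finite S
≐initSeg⇒finite n S≐ = finite-≐ (≐-sym S≐) (initSeg-finite {n})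

initSeg-injective : initSeg m ≐ initSeg n → m ≡ n
initSeg-injective {m} {n} m≐n with <-cmp m n
... | tri< m<n _ _ = ⊥-elim (true≢false (trans (sym (initSeg-∈ m<n)) (trans (sym (m≐n m)) (initSeg-∉ {m} ≤-refl))))
... | tri≈ _ m≡n _ = m≡n
... | tri> _ _ n<m = ⊥-elim (true≢false (trans (sym (initSeg-∈ n<m)) (trans (m≐n n) (initSeg-∉ {n} ≤-refl))))

coSingleton-cofinite : Eventually (λ k → coSingleton n k ≡ true)
coSingleton-cofinite {n} = suc n , λ k n<k → coSingleton-∈ (>⇒≢ n<k)

≐coSingleton⇒infinite : S ≐ coSingleton n → Infinite S
≐coSingleton⇒infinite S≐ = cofinite-infinite (eventually-mono (λ {k} p → trans (S≐ k) p) coSingleton-cofinite)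

≐coSingleton⇒¬EStar : S ≐ coSingleton n → ¬ EStar S
≐coSingleton⇒¬EStar {S} S≐ (_ , finite-oddPart , _) =
  infinite-along (λ m → suc (m * 2)) ≤-1+*2 (eventually-mono (λ {m} → oddPart-odd {S} m) S-odd) finite-oddPart
  where
  S-odd : Eventually (λ m → S (suc (m * 2)) ≡ true)
  S-odd = eventually-along (λ m → suc (m * 2)) ≤-1+*2
            (eventually-mono (λ {k} p → trans (S≐ k) p) coSingleton-cofinite)

coSingleton-injective : coSingleton m ≐ coSingleton n → m ≡ n
coSingleton-injective {m} m≐n = coSingleton-∉⁻ (trans (sym (m≐n m)) (coSingleton-∉ {m}))

⊇coSingleton : S ≐ coSingleton n → S ⊆ T → T n ≡ false → T ≐ coSingleton n
⊇coSingleton {n = n} S≐ S⊆T T∌n k with k ≟ n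
... | yes refl = trans T∌n (sym (coSingleton-∉ {n}))
... | no k≢n   = trans (S⊆T (trans (S≐ k) (coSingleton-∈ k≢n))) (sym (coSingleton-∈ k≢n))

IsMax-≐ : S ≐ T → IsMax T M → IsMax S M
IsMax-≐ {M = M} S≐T (T∋M , T-above) = trans (S≐T M) T∋M , λ {k} M<k → trans (S≐T k) (T-above M<k)

initSeg-max : IsMax (initSeg (suc M)) M
initSeg-max {M} = initSeg-∈ {M} ≤-refl , λ {k} → initSeg-∉ {suc M} {k}

max-finite : IsMax S M → Finite S
max-finite {M = M} (_ , S-above) = suc M , λ _ → S-above

max-unique : IsMax S m → IsMax S n → m ≡ n
max-unique {m = m} {n} (S∋m , S-above-m) (S∋n , S-above-n) with <-cmp m n
... | tri< m<n _ _ = ⊥-elim (true≢false (trans (sym S∋n) (S-above-m m<n)))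
... | tri≈ _ m≡n _ = m≡n
... | tri> _ _ n<m = ⊥-elim (true≢false (trans (sym S∋m) (S-above-n n<m)))

max-∪ : IsMax (S ∪ T) M → IsMax S M ⊎ IsMax T M
max-∪ {S} {T} (S∪T∋M , above) with ∪-∈ {S} {T} S∪T∋M
... | inj₁ S∋M = inj₁ (S∋M , λ M<k → proj₁ (∪-∌ {S} {T} (above M<k)))
... | inj₂ T∋M = inj₂ (T∋M , λ M<k → proj₂ (∪-∌ {S} {T} (above M<k)))

maxBelow-isMax : ∀ N → (∀ k → N ≤ k → S k ≡ false) → S ≐ ∅ ⊎ IsMax S (maxBelow N S)
maxBelow-isMax zero bound = inj₁ λ k → bound k z≤n
maxBelow-isMax {S} (suc N) bound with S N in S∋N
... | true  = inj₂ (S∋N , λ {k} → bound k)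
... | false = maxBelow-isMax N λ k N≤k →
  [ (λ N<k → bound k N<k) , (λ { refl → S∋N }) ] (m≤n⇒m<n∨m≡n N≤k)

powerset-isBooleanAlgebra :
  IsBooleanAlgebra _≐_ (λ S T k → S k ∨ᵈ T k) (λ S T k → S k ∧ T k) (λ S k → not (S k)) univ ∅
powerset-isBooleanAlgebra = isBooleanAlgebraʳ record
  { isDistributiveLattice = isDistributiveLatticeʳʲᵐ record
    { isLattice = record
      { isEquivalence = ≐-isEquivalence
      ; ∨-comm     = λ S T k → ∨ᵈ-comm (S k) (T k)
      ; ∨-assoc    = λ S T U k → ∨ᵈ-assoc (S k) (T k) (U k)
      ; ∨-cong     = λ S≐T U≐V k → cong₂ _∨ᵈ_ (S≐T k) (U≐V k)
      ; ∧-comm     = λ S T k → Boolₚ.∧-comm (S k) (T k)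
      ; ∧-assoc    = λ S T U k → Boolₚ.∧-assoc (S k) (T k) (U k)
      ; ∧-cong     = λ S≐T U≐V k → cong₂ _∧_ (S≐T k) (U≐V k)
      ; absorptive = (λ S T k → ∨ᵈ-absorbs-∧ (S k) (T k)) , (λ S T k → ∧-absorbs-∨ᵈ (S k) (T k))
      }
    ; ∨-distribʳ-∧ = λ S T U k → ∨ᵈ-distribʳ-∧ (S k) (T k) (U k)
    }
  ; ∨-complementʳ = λ S k → ∨ᵈ-complementʳ (S k)
  ; ∧-complementʳ = λ S k → Boolₚ.∧-inverseʳ (S k)
  ; ¬-cong        = λ S≐T k → cong not (S≐T k)
  }
  where
  ∨ᵈ-comm : ∀ a b → a ∨ᵈ b ≡ b ∨ᵈ a
  ∨ᵈ-comm a b rewrite ∨ᵈ≡∨ a b | ∨ᵈ≡∨ b a = Boolₚ.∨-comm a b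
  ∨ᵈ-assoc : ∀ a b c → (a ∨ᵈ b) ∨ᵈ c ≡ a ∨ᵈ (b ∨ᵈ c)
  ∨ᵈ-assoc a b c
    rewrite ∨ᵈ≡∨ a b | ∨ᵈ≡∨ (a ∨ b) c | ∨ᵈ≡∨ b c | ∨ᵈ≡∨ a (b ∨ c) = Boolₚ.∨-assoc a b c
  ∨ᵈ-absorbs-∧ : ∀ a b → a ∨ᵈ (a ∧ b) ≡ a
  ∨ᵈ-absorbs-∧ a b rewrite ∨ᵈ≡∨ a (a ∧ b) = Boolₚ.∨-abs-∧ a b
  ∧-absorbs-∨ᵈ : ∀ a b → a ∧ (a ∨ᵈ b) ≡ a
  ∧-absorbs-∨ᵈ a b rewrite ∨ᵈ≡∨ a b = Boolₚ.∧-abs-∨ a b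
  ∨ᵈ-distribʳ-∧ : ∀ a b c → (b ∧ c) ∨ᵈ a ≡ (b ∨ᵈ a) ∧ (c ∨ᵈ a)
  ∨ᵈ-distribʳ-∧ a b c
    rewrite ∨ᵈ≡∨ (b ∧ c) a | ∨ᵈ≡∨ b a | ∨ᵈ≡∨ c a = Boolₚ.∨-distribʳ-∧ a b c
  ∨ᵈ-complementʳ : ∀ a → a ∨ᵈ not a ≡ true
  ∨ᵈ-complementʳ a rewrite ∨ᵈ≡∨ a (not a) = Boolₚ.∨-inverseʳ a

EStar-≐ : S ≐ T → EStar S → EStar T
EStar-≐ S≐T (inf , finite-oddPart , finite-evenGap) =
  (λ finT → inf (finite-≐ (≐-sym S≐T) finT)) ,
  finite-≐ (λ k → cong (not (isEven k) ∧_) (S≐T k)) finite-oddPart ,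
  finite-≐ (λ k → cong (λ b → isEven k ∧ not b) (S≐T k)) finite-evenGap

EStar-⊇ : S ⊆ T → Finite (oddPart T) → EStar S → EStar T
EStar-⊇ {S} {T} S⊆T finite-oddPart (inf , _ , finite-evenGap) =
  (λ finT → inf (finite-⊆ {S} {T} S⊆T finT)) ,
  finite-oddPart ,
  finite-⊆ (evenGap-antitone {S} {T} S⊆T) finite-evenGap

finite-oddPart : Finite S → Finite (oddPart S)
finite-oddPart {S} = finite-⊆ {oddPart S} {S} λ {k} → proj₂ ∘ ∧-true⁻ {not (isEven k)}

finite-oddPart-∪ : Finite (oddPart S) → Finite (oddPart T) → Finite (oddPart (S ∪ T))
finite-oddPart-∪ {S} {T} finS finT =
  finite-≐ (λ k → sym (Boolₚ.∧-distribˡ-∨ (not (isEven k)) (S k) (T k))) (finite-∪ finS finT)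

｛｝-finite : Finite ｛ n ｝
｛｝-finite {n} = suc n , λ k n<k → ｛｝-∉ (>⇒≢ n<k)

-- Sets that eventually agree with ∅, the evens, the odds or ℕ

byParity : Bool → Bool → Subset
byParity e o k = if isEven k then e else o

byParity-even : ∀ m → byParity a b (m * 2) ≡ a
byParity-even m rewrite isEven-even m = refl

byParity-odd : ∀ m → byParity a b (suc (m * 2)) ≡ b
byParity-odd m rewrite isEven-odd m = refl

byParity-const : ∀ k → byParity a a k ≡ a
byParity-const k with isEven k
... | true  = refl
... | false = refl

byParity-isEven : ∀ k → isEven k ≡ byParity true false k
byParity-isEven k with isEven k
... | true  = refl
... | false = refl

byParity-∧ : ∀ {a b a′ b′} k → byParity a b k ∧ byParity a′ b′ k ≡ byParity (a ∧ a′) (b ∧ b′) k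
byParity-∧ k with isEven k
... | true  = refl
... | false = refl

byParity-not : ∀ k → not (byParity a b k) ≡ byParity (not a) (not b) k
byParity-not k with isEven k
... | true  = refl
... | false = refl

record ParityTail (S : Subset) : Set where
  constructor parityTail
  field
    evens odds : Bool
    tail       : Eventually (λ k → S k ≡ byParity evens odds k)

tail-evens : Eventually (λ k → S k ≡ byParity a b k) → Eventually (λ m → S (m * 2) ≡ a)
tail-evens = eventually-mono (λ {m} S≡ → trans S≡ (byParity-even m)) ∘ eventually-along (_* 2) ≤-*2

tail-odds : Eventually (λ k → S k ≡ byParity a b k) → Eventually (λ m → S (suc (m * 2)) ≡ b)
tail-odds =
  eventually-mono (λ {m} S≡ → trans S≡ (byParity-odd m)) ∘ eventually-along (λ m → suc (m * 2)) ≤-1+*2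

tail-odds-unique : ∀ {a b a′ b′} →
  Eventually (λ k → S k ≡ byParity a b k) → Eventually (λ k → S k ≡ byParity a′ b′ k) → b ≡ b′
tail-odds-unique tail tail′ with eventually-sample (eventually-zip (tail-odds tail) (tail-odds tail′))
... | _ , S≡b , S≡b′ = trans (sym S≡b) S≡b′

evensTail-EStar : Eventually (λ k → S k ≡ byParity true false k) → EStar S
evensTail-EStar {S} tail =
  infinite-along (_* 2) ≤-*2 (tail-evens tail) ,
  eventually-mono (λ {k} → oddPart-∌ k) tail ,
  eventually-mono (λ {k} → evenGap-∌ k) tail
  where
  oddPart-∌ : ∀ k → S k ≡ byParity true false k → oddPart S k ≡ false
  oddPart-∌ k S≡ with isEven k
  ... | true  = refl
  ... | false = S≡
  evenGap-∌ : ∀ k → S k ≡ byParity true false k → evenGap S k ≡ false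
  evenGap-∌ k S≡ with isEven k
  ... | true  = cong not S≡
  ... | false = refl

oddsTail-infinite : Eventually (λ k → S k ≡ byParity false true k) → Infinite S
oddsTail-infinite = infinite-along (λ m → suc (m * 2)) ≤-1+*2 ∘ tail-odds

oddsTail-evenGap-infinite : Eventually (λ k → S k ≡ byParity false true k) → Infinite (evenGap S)
oddsTail-evenGap-infinite {S} =
  infinite-along (_* 2) ≤-*2 ∘ eventually-mono (λ {m} → evenGap-even {S} m) ∘ tail-evens

halfEven : Subset
halfEven k = isEven (k / 2)

evens∩halfEven : Subset
evens∩halfEven k = isEven k ∧ halfEven k

evens∩halfEven-at : ∀ j → evens∩halfEven (j * 2) ≡ isEven j
evens∩halfEven-at j = cong₂ _∧_ (isEven-even j) (cong isEven (m*n/n≡m j 2))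

evens∩halfEven-infinite : Infinite evens∩halfEven
evens∩halfEven-infinite = infinite-along (λ m → m * 2 * 2) (λ m → ≤-trans (≤-*2 m) (≤-*2 (m * 2)))
  (0 , λ m _ → trans (evens∩halfEven-at (m * 2)) (isEven-even m))

evens∩halfEven-evenGap-infinite : Infinite (evenGap evens∩halfEven)
evens∩halfEven-evenGap-infinite = infinite-along (λ m → suc (m * 2) * 2) (λ m → ≤-trans (≤-1+*2 m) (≤-*2 _))
  (0 , λ m _ → evenGap-even {evens∩halfEven} (suc (m * 2)) (trans (evens∩halfEven-at (suc (m * 2))) (isEven-odd m)))

-- The Boolean frames 𝔠_X

fⁿ𝟘ₜ : ℕ → Term V
fⁿ𝟘ₜ zero    = 𝟘ₜ
fⁿ𝟘ₜ (suc n) = fₜ (fⁿ𝟘ₜ n)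

coSingletonₜ : ℕ → Term V
coSingletonₜ n = -ₜ (fⁿ𝟘ₜ (suc n) ⊓ₜ -ₜ fⁿ𝟘ₜ n)

subadditivityˡ subadditivityʳ : Term Bool
subadditivityʳ = fₜ (var true ⊔ₜ var false)
subadditivityˡ = subadditivityʳ ⊓ₜ (fₜ (var true) ⊔ₜ fₜ (var false))

module Frame (lem : LEM) (X : Subset) where

  gₓ : Subset → Subset
  gₓ = g lem X

  XCoSingleton : Subset → Set
  XCoSingleton S = Σ ℕ λ n → (S ≐ coSingleton n) × (X n ≡ true)

  -- G stands for g S: taking it as a parameter makes the type of `clause` mention g S, so
  -- that the with-abstractions of `clause` reduce g.
  data Clause (S G : Subset) : Set where
    initial   : ∀ n → S ≐ initSeg n → G ≐ initSeg (suc n) → Clause S G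
    eStar     : EStar S → G ≐ S → Clause S G
    coSingle  : ∀ n → S ≐ coSingleton n → X n ≡ true → G ≐ coSingleton n → Clause S G
    successor : ¬ InitialSegment S → ∀ M → IsMax S M → G ≐ (S ∪ ｛ suc M ｝) → Clause S G
    full      : Infinite S → ¬ EStar S → ¬ XCoSingleton S → G ≐ univ → Clause S G

  clause : ∀ S → Clause S (gₓ S)
  clause S with lem (InitialSegment S)
  ... | yes (n , S≐n) = initial n S≐n λ _ → refl
  ... | no ¬init with lem (EStar S)
  ...   | yes e = eStar e λ _ → refl
  ...   | no ¬e with lem (XCoSingleton S)
  ...     | yes (n , S≐n , Xn) = coSingle n S≐n Xn λ _ → refl
  ...     | no ¬c with lem (Finite S)
  ...       | no ¬fin = full ¬fin ¬e ¬c λ _ → refl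
  ...       | yes (N , bound) with maxBelow-isMax N bound
  ...         | inj₁ S≐∅ = ⊥-elim (¬init (0 , S≐∅))
  ...         | inj₂ max = successor ¬init _ max λ _ → refl

  g-initSeg : S ≐ initSeg n → gₓ S ≐ initSeg (suc n)
  g-initSeg {S} {n} S≐n with clause S
  ... | initial m S≐m g≐ =
    λ k → trans (g≐ k) (cong (λ j → initSeg (suc j) k) (initSeg-injective (≐-trans (≐-sym S≐m) S≐n)))
  ... | eStar e _              = ⊥-elim (proj₁ e (≐initSeg⇒finite n S≐n))
  ... | coSingle _ S≐m _ _     = ⊥-elim (≐coSingleton⇒infinite S≐m (≐initSeg⇒finite n S≐n))
  ... | successor ¬init _ _ _  = ⊥-elim (¬init (n , S≐n))
  ... | full inf _ _ _         = ⊥-elim (inf (≐initSeg⇒finite n S≐n))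

  g-EStar : EStar S → gₓ S ≐ S
  g-EStar {S} e with clause S
  ... | initial n S≐n _       = ⊥-elim (proj₁ e (≐initSeg⇒finite n S≐n))
  ... | eStar _ g≐            = g≐
  ... | coSingle _ S≐n _ _    = ⊥-elim (≐coSingleton⇒¬EStar S≐n e)
  ... | successor _ _ max _   = ⊥-elim (proj₁ e (max-finite max))
  ... | full _ ¬e _ _         = ⊥-elim (¬e e)

  g-coSingleton : S ≐ coSingleton n → X n ≡ true → gₓ S ≐ coSingleton n
  g-coSingleton {S} {n} S≐n Xn with clause S
  ... | initial m S≐m _      = ⊥-elim (≐coSingleton⇒infinite S≐n (≐initSeg⇒finite m S≐m))
  ... | eStar e _            = ⊥-elim (≐coSingleton⇒¬EStar S≐n e)
  ... | coSingle m S≐m _ g≐ =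
    λ k → trans (g≐ k) (cong (λ j → coSingleton j k) (coSingleton-injective (≐-trans (≐-sym S≐m) S≐n)))
  ... | successor _ _ max _  = ⊥-elim (≐coSingleton⇒infinite S≐n (max-finite max))
  ... | full _ _ ¬c _        = ⊥-elim (¬c (n , S≐n , Xn))

  g-successor : ¬ InitialSegment S → IsMax S M → gₓ S ≐ (S ∪ ｛ suc M ｝)
  g-successor {S} ¬init max with clause S
  ... | initial n S≐n _        = ⊥-elim (¬init (n , S≐n))
  ... | eStar e _              = ⊥-elim (proj₁ e (max-finite max))
  ... | coSingle _ S≐n _ _     = ⊥-elim (≐coSingleton⇒infinite S≐n (max-finite max))
  ... | successor _ _ max′ g≐ = λ k → trans (g≐ k) (cong (λ j → S k ∨ ｛ suc j ｝ k) (max-unique max′ max))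
  ... | full inf _ _ _         = ⊥-elim (inf (max-finite max))

  g-top : Infinite S → ¬ EStar S → ¬ XCoSingleton S → gₓ S ≐ univ
  g-top {S} inf ¬e ¬c with clause S
  ... | initial n S≐n _        = ⊥-elim (inf (≐initSeg⇒finite n S≐n))
  ... | eStar e _              = ⊥-elim (¬e e)
  ... | coSingle n S≐n Xn _    = ⊥-elim (¬c (n , S≐n , Xn))
  ... | successor _ _ max _    = ⊥-elim (inf (max-finite max))
  ... | full _ _ _ g≐          = g≐

  g-cong : S ≐ T → gₓ S ≐ gₓ T
  g-cong {S} {T} S≐T with clause S
  ... | initial n S≐n g≐ = ≐-trans g≐ (≐-sym (g-initSeg (≐-trans (≐-sym S≐T) S≐n)))
  ... | eStar e g≐ = ≐-trans g≐ (≐-trans S≐T (≐-sym (g-EStar (EStar-≐ S≐T e))))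
  ... | coSingle n S≐n Xn g≐ = ≐-trans g≐ (≐-sym (g-coSingleton (≐-trans (≐-sym S≐T) S≐n) Xn))
  ... | successor ¬init M max g≐ =
    λ k → trans (g≐ k) (trans (cong (_∨ ｛ suc M ｝ k) (S≐T k))
                              (sym (g-successor ¬initT (IsMax-≐ (≐-sym S≐T) max) k)))
    where
    ¬initT : ¬ InitialSegment T
    ¬initT (n , T≐n) = ¬init (n , ≐-trans S≐T T≐n)
  ... | full inf ¬e ¬c g≐ = ≐-trans g≐ (≐-sym (g-top
    (λ finT → inf (finite-≐ (≐-sym S≐T) finT))
    (λ e → ¬e (EStar-≐ (≐-sym S≐T) e))
    (λ (n , T≐n , Xn) → ¬c (n , ≐-trans S≐T T≐n , Xn))))

  g-extensive : S ⊆ gₓ S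
  g-extensive {S} {k} S∋k with clause S
  ... | initial n S≐n g≐     =
    trans (g≐ k) (initSeg-∈ {k} {suc n} (m≤n⇒m≤1+n (initSeg-∈⁻ (trans (sym (S≐n k)) S∋k))))
  ... | eStar _ g≐           = trans (g≐ k) S∋k
  ... | coSingle _ S≐n _ g≐  = trans (g≐ k) (trans (sym (S≐n k)) S∋k)
  ... | successor _ M _ g≐   = trans (g≐ k) (∪-⊆ˡ {S} {｛ suc M ｝} S∋k)
  ... | full _ _ _ g≐        = g≐ k

  g-above-max : IsMax S M → gₓ S (suc M) ≡ true
  g-above-max {S} {M} max with clause S
  ... | initial n S≐n g≐ =
    trans (g≐ (suc M)) (initSeg-∈ {suc M} {suc n} (s≤s (initSeg-∈⁻ (trans (sym (S≐n M)) (proj₁ max)))))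
  ... | eStar e _ = ⊥-elim (proj₁ e (max-finite max))
  ... | coSingle _ S≐n _ _ = ⊥-elim (≐coSingleton⇒infinite S≐n (max-finite max))
  ... | successor _ M′ max′ g≐ rewrite max-unique max′ max =
    trans (g≐ (suc M)) (∪-⊆ʳ {｛ suc M ｝} {S} (｛｝-∈ {suc M}))
  ... | full _ _ _ g≐ = g≐ (suc M)

  g-finite : Finite S → Finite (gₓ S)
  g-finite {S} fin with clause S
  ... | initial n _ g≐       = finite-≐ (≐-sym g≐) (initSeg-finite {suc n})
  ... | eStar e _            = ⊥-elim (proj₁ e fin)
  ... | coSingle _ S≐n _ _   = ⊥-elim (≐coSingleton⇒infinite S≐n fin)
  ... | successor _ _ _ g≐   = finite-≐ (≐-sym g≐) (finite-∪ fin ｛｝-finite)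
  ... | full inf _ _ _       = ⊥-elim (inf fin)

  g-full : Infinite S → Infinite (evenGap S) → gₓ S ≐ univ
  g-full {S} inf gap-inf = g-top inf (λ e → gap-inf (proj₂ (proj₂ e))) ¬XCoSingleton
    where
    ¬XCoSingleton : ¬ XCoSingleton S
    ¬XCoSingleton (n , S≐n , _) = gap-inf (finite-⊆ {evenGap S} {｛ n ｝} gap⊆n ｛｝-finite)
      where
      gap⊆n : evenGap S ⊆ ｛ n ｝
      gap⊆n {k} k∈gap
        with coSingleton-∉⁻ {n} {k} (trans (sym (S≐n k)) (not-true⁻ (proj₂ (∧-true⁻ {isEven k} k∈gap))))
      ... | refl = ｛｝-∈ {n}

  Exceptional : Subset → Set
  Exceptional S = Finite S ⊎ EStar S ⊎ XCoSingleton S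

  g-∌⇒exceptional : gₓ S k ≡ false → Exceptional S
  g-∌⇒exceptional {S} {k} g∌k with clause S
  ... | initial n S≐n _      = inj₁ (≐initSeg⇒finite n S≐n)
  ... | eStar e _            = inj₂ (inj₁ e)
  ... | coSingle n S≐n Xn _  = inj₂ (inj₂ (n , S≐n , Xn))
  ... | successor _ _ max _  = inj₁ (max-finite max)
  ... | full _ _ _ g≐        = ⊥-elim (true≢false (trans (sym (g≐ k)) g∌k))

  XCoSingleton-⊇ : S ⊆ T → T k ≡ false → XCoSingleton S → XCoSingleton T
  XCoSingleton-⊇ {S} {T} {k} S⊆T T∌k (n , S≐n , Xn)
    with coSingleton-∉⁻ {n} {k} (trans (sym (S≐n k)) (⊆-∌ {S} {T} S⊆T T∌k))
  ... | refl = n , ⊇coSingleton S≐n S⊆T T∌k , Xn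

  ∪-exceptional : (S ∪ T) k ≡ false → Exceptional S → Exceptional T → Exceptional (S ∪ T)
  ∪-exceptional {S} {T} U∌k (inj₂ (inj₂ c)) _ = inj₂ (inj₂ (XCoSingleton-⊇ (∪-⊆ˡ {S} {T}) U∌k c))
  ∪-exceptional {S} {T} U∌k _ (inj₂ (inj₂ c)) = inj₂ (inj₂ (XCoSingleton-⊇ (∪-⊆ʳ {T} {S}) U∌k c))
  ∪-exceptional _ (inj₁ finS) (inj₁ finT) = inj₁ (finite-∪ finS finT)
  ∪-exceptional {S} {T} _ (inj₂ (inj₁ eS)) (inj₁ finT) =
    inj₂ (inj₁ (EStar-⊇ (∪-⊆ˡ {S} {T}) (finite-oddPart-∪ {S} {T} (proj₁ (proj₂ eS)) (finite-oddPart finT)) eS))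
  ∪-exceptional {S} {T} _ (inj₂ (inj₁ eS)) (inj₂ (inj₁ eT)) =
    inj₂ (inj₁ (EStar-⊇ (∪-⊆ˡ {S} {T}) (finite-oddPart-∪ {S} {T} (proj₁ (proj₂ eS)) (proj₁ (proj₂ eT))) eS))
  ∪-exceptional {S} {T} _ (inj₁ finS) (inj₂ (inj₁ eT)) =
    inj₂ (inj₁ (EStar-⊇ (∪-⊆ʳ {T} {S}) (finite-oddPart-∪ {S} {T} (finite-oddPart finS) (proj₁ (proj₂ eT))) eT))

  g-above-max-∪ : IsMax (S ∪ T) M → gₓ S (suc M) ≡ true ⊎ gₓ T (suc M) ≡ true
  g-above-max-∪ {S} {T} max with max-∪ {S} {T} max
  ... | inj₁ maxS = inj₁ (g-above-max maxS)
  ... | inj₂ maxT = inj₂ (g-above-max maxT)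

  g-subadditive-∉ : (S ∪ T) k ≡ false → gₓ (S ∪ T) k ≡ true → gₓ S k ≡ true ⊎ gₓ T k ≡ true
  g-subadditive-∉ {S} {T} {k} U∌k g∋k with clause (S ∪ T)
  ... | initial n U≐n g≐ with initSeg-suc-new n (trans (sym (g≐ k)) g∋k) (trans (sym (U≐n k)) U∌k)
  ...   | refl = new-point n U≐n
    where
    new-point : ∀ n → (S ∪ T) ≐ initSeg n → gₓ S n ≡ true ⊎ gₓ T n ≡ true
    new-point zero    U≐∅ = inj₁ (g-initSeg {S} {0} (λ j → ⊆-∌ {S} {S ∪ T} (∪-⊆ˡ {S} {T}) (U≐∅ j)) 0)
    new-point (suc M) U≐n = g-above-max-∪ {S} {T} (IsMax-≐ U≐n initSeg-max)
  g-subadditive-∉ {S} {T} {k} U∌k g∋k | eStar _ g≐ =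
    ⊥-elim (true≢false (trans (sym g∋k) (trans (g≐ k) U∌k)))
  g-subadditive-∉ {S} {T} {k} U∌k g∋k | coSingle _ U≐n _ g≐ =
    ⊥-elim (true≢false (trans (sym g∋k) (trans (g≐ k) (trans (sym (U≐n k)) U∌k))))
  g-subadditive-∉ {S} {T} {k} U∌k g∋k | successor _ M max g≐
    with ｛｝-∈⁻ {suc M} {k} (∪-∈ʳ {S ∪ T} {｛ suc M ｝} (trans (sym (g≐ k)) g∋k) U∌k)
  ... | refl = g-above-max-∪ {S} {T} max
  g-subadditive-∉ {S} {T} {k} U∌k g∋k | full inf ¬e ¬c _ with gₓ S k in gS∋k | gₓ T k in gT∋k
  ... | true  | _     = inj₁ refl
  ... | false | true  = inj₂ refl
  ... | false | false with ∪-exceptional {S} {T} U∌k (g-∌⇒exceptional gS∋k) (g-∌⇒exceptional gT∋k)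
  ...   | inj₁ fin             = ⊥-elim (inf fin)
  ...   | inj₂ (inj₁ e)        = ⊥-elim (¬e e)
  ...   | inj₂ (inj₂ c)        = ⊥-elim (¬c c)

  g-subadditive : gₓ (S ∪ T) k ≡ true → gₓ S k ≡ true ⊎ gₓ T k ≡ true
  g-subadditive {S} {T} {k} g∋k with S k in S∋k | T k in T∋k
  ... | true  | _     = inj₁ (g-extensive S∋k)
  ... | false | true  = inj₂ (g-extensive T∋k)
  ... | false | false = g-subadditive-∉ {S} {T} (cong₂ _∨_ S∋k T∋k) g∋k

  𝔠-BF : BF
  𝔠-BF = record { raw = 𝔠 lem X ; isBA = powerset-isBooleanAlgebra ; f-cong = g-cong }

  subadditive : 𝔠-BF ⊨ subadditivityˡ ≈ₜ subadditivityʳ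
  subadditive ρ k = ∧-absorbs-implied λ g∋k →
    ∨ᵈ-true (g-subadditive {ρ true} {ρ false} {k} (trans (sym (g-cong ⊔≐∪ k)) g∋k))
    where
    ⊔≐∪ : (λ j → ρ true j ∨ᵈ ρ false j) ≐ (ρ true ∪ ρ false)
    ⊔≐∪ j = ∨ᵈ≡∨ (ρ true j) (ρ false j)

  eval-fⁿ𝟘 : ∀ (ρ : V → Subset) n → eval (𝔠 lem X) ρ (fⁿ𝟘ₜ n) ≐ initSeg n
  eval-fⁿ𝟘 ρ zero    = λ _ → refl
  eval-fⁿ𝟘 ρ (suc n) = g-initSeg (eval-fⁿ𝟘 ρ n)

  eval-coSingletonₜ : ∀ (ρ : V → Subset) n → eval (𝔠 lem X) ρ (coSingletonₜ n) ≐ coSingleton n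
  eval-coSingletonₜ ρ n k =
    cong not (trans (cong₂ (λ a b → a ∧ not b) (eval-fⁿ𝟘 ρ (suc n) k) (eval-fⁿ𝟘 ρ n k))
                    (initSeg-suc∖initSeg n k))

  coSingleton-identity-holds : X n ≡ false → 𝔠-BF ⊨ fₜ (coSingletonₜ {V} n) ≈ₜ 𝟙ₜ
  coSingleton-identity-holds {n} Xn ρ = ≐-trans (g-cong (eval-coSingletonₜ ρ n)) (g-top
    (≐coSingleton⇒infinite (λ _ → refl))
    (≐coSingleton⇒¬EStar (λ _ → refl))
    (λ (m , n≐m , Xm) → true≢false (trans (sym Xm) (trans (cong X (sym (coSingleton-injective n≐m))) Xn))))

  coSingleton-identity-fails : X n ≡ true → ¬ 𝔠-BF ⊨ fₜ (coSingletonₜ {⊥} n) ≈ₜ 𝟙ₜ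
  coSingleton-identity-fails {n} Xn holds = true≢false (begin
    true                                         ≡⟨ holds (λ ()) n ⟨
    gₓ (eval (𝔠 lem X) (λ ()) (coSingletonₜ n)) n ≡⟨ g-cong (eval-coSingletonₜ (λ ()) n) n ⟩
    gₓ (coSingleton n) n                         ≡⟨ g-coSingleton (λ _ → refl) Xn n ⟩
    coSingleton n n                              ≡⟨ coSingleton-∉ {n} ⟩
    false                                        ∎)
    where open ≡-Reasoning

  ⊓-tail : ParityTail S → ParityTail T → ParityTail (λ k → S k ∧ T k)
  ⊓-tail (parityTail a b tailS) (parityTail a′ b′ tailT) = parityTail (a ∧ a′) (b ∧ b′)
    (eventually-mono (λ {k} (S≡ , T≡) → trans (cong₂ _∧_ S≡ T≡) (byParity-∧ k))
                     (eventually-zip tailS tailT))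

  -‿tail : ParityTail S → ParityTail (λ k → not (S k))
  -‿tail (parityTail a b tailS) = parityTail (not a) (not b)
    (eventually-mono (λ {k} S≡ → trans (cong not S≡) (byParity-not k)) tailS)

  ∅-tail : ParityTail ∅
  ∅-tail = parityTail false false (0 , λ k _ → sym (byParity-const k))

  g-tail-evens : ∀ a b → Eventually (λ k → S k ≡ byParity a b k) →
                 Σ Bool λ a′ → Eventually (λ k → gₓ S k ≡ byParity a′ b k)
  g-tail-evens false false tailS = false ,
    eventually-mono (λ {k} g∌k → trans g∌k (sym (byParity-const k)))
      (g-finite (eventually-mono (λ {k} S≡ → trans S≡ (byParity-const k)) tailS))
  g-tail-evens true false tailS = true ,
    eventually-mono (λ {k} S≡ → trans (g-EStar (evensTail-EStar tailS) k) S≡) tailS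
  g-tail-evens true true tailS = true ,
    eventually-mono (λ {k} S≡ → trans (g-extensive (trans S≡ (byParity-const k))) (sym (byParity-const k))) tailS
  g-tail-evens false true tailS = true ,
    (0 , λ k _ → trans (g-full (oddsTail-infinite tailS) (oddsTail-evenGap-infinite tailS) k) (sym (byParity-const k)))

  -- Keeping the odd tail b is what makes f-comp of sameOddTail hold definitionally.
  g-tail : ParityTail S → ParityTail (gₓ S)
  g-tail (parityTail a b tailS) = parityTail (proj₁ (g-tail-evens a b tailS)) b (proj₂ (g-tail-evens a b tailS))

  open Subalgebra 𝔠-BF ParityTail ⊓-tail -‿tail ∅-tail g-tail
    renaming (sub to D; inclusion to D↪C; inclusion-injective to D↪C-injective)

  oddTail : BF.Carrier D → Bool
  oddTail = ParityTail.odds ∘ proj₂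

  sameOddTail : Congruence D
  sameOddTail = record
    { Θ        = λ x y → oddTail x ≡ oddTail y
    ; isEquiv  = On.isEquivalence oddTail ≡-isEquivalence
    ; ≈⊆Θ      = λ {x} {y} x≈y → tail-odds-unique (ParityTail.tail (proj₂ x))
                   (eventually-mono (λ {k} y≡ → trans (x≈y k) y≡) (ParityTail.tail (proj₂ y)))
    ; ⊓-comp   = cong₂ _∧_
    ; neg-comp = cong not
    ; f-comp   = λ same → same
    }

  Restricts-to-sameOddTail : Congruence 𝔠-BF → Set
  Restricts-to-sameOddTail Ψ = ∀ x y →
    (Congruence.Θ Ψ (proj₁ x) (proj₁ y) → oddTail x ≡ oddTail y) ×
    (oddTail x ≡ oddTail y → Congruence.Θ Ψ (proj₁ x) (proj₁ y))

  sameOddTail-unextendable : ∀ Ψ → ¬ Restricts-to-sameOddTail Ψ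
  sameOddTail-unextendable Ψ restricts = true≢false (proj₁ (restricts univD ∅D) univ∼∅)
    where
    open Congruence Ψ renaming (Θ to _∼_)

    evensD ∅D oneD univD : BF.Carrier D
    evensD = isEven , parityTail true false (0 , λ k _ → byParity-isEven k)
    ∅D     = ∅ , ∅-tail
    oneD   = initSeg 1 ,
             parityTail false false (1 , λ k 1≤k → trans (initSeg-∉ {1} {k} 1≤k) (sym (byParity-const k)))
    univD  = univ , parityTail true true (0 , λ k _ → sym (byParity-const k))

    Ψ-setoid : Setoid 0ℓ 0ℓ
    Ψ-setoid = record { isEquivalence = isEquiv }
    open ≈-Reasoning Ψ-setoid

    univ∼∅ : univ ∼ ∅
    univ∼∅ = begin
      univ               ≈⟨ ≈⊆Θ (≐-sym (g-full evens∩halfEven-infinite evens∩halfEven-evenGap-infinite)) ⟩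
      gₓ evens∩halfEven  ≈⟨ f-comp (⊓-comp (proj₂ (restricts evensD ∅D) refl) (≈⊆Θ {halfEven} (λ _ → refl))) ⟩
      gₓ ∅               ≈⟨ ≈⊆Θ (g-initSeg {∅} {0} (λ _ → refl)) ⟩
      initSeg 1          ≈⟨ proj₂ (restricts oneD ∅D) refl ⟩
      ∅                  ∎

  ¬CEP : ¬ CEP 𝔠-BF
  ¬CEP cep = sameOddTail-unextendable Ψ restricts
    where
    extension : Σ (Congruence 𝔠-BF) Restricts-to-sameOddTail
    extension = cep D D↪C D↪C-injective sameOddTail
    Ψ = proj₁ extension
    restricts = proj₂ extension

module _ (lem : LEM) where
  open Frame lem using (𝔠-BF; subadditive; coSingleton-identity-holds; coSingleton-identity-fails; ¬CEP)

  HSP-subadditive : ∀ X {B} → HSP (𝔠 lem X) B → Subadditive B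
  HSP-subadditive X {B} hsp x y =
    ⊨-HSP (𝔠-BF X) {subadditivityˡ} {subadditivityʳ} (subadditive X) {B} hsp λ v → if v then x else y

  HSP-separates : ∀ {X Y n} → X n ≡ true → Y n ≡ false → ¬ HSP (𝔠 lem Y) (𝔠-BF X)
  HSP-separates {X} {Y} {n} Xn Yn hsp =
    coSingleton-identity-fails X Xn
      (⊨-HSP (𝔠-BF Y) {fₜ (coSingletonₜ n)} {𝟙ₜ} (coSingleton-identity-holds Y Yn) {𝔠-BF X} hsp)

  HSP-injective : ∀ X Y → SameClass (HSP (𝔠 lem X)) (HSP (𝔠 lem Y)) → ∀ n → X n ≡ Y n
  HSP-injective X Y same n with X n in Xn | Y n in Yn
  ... | true  | true  = refl
  ... | false | false = refl
  ... | true  | false = ⊥-elim (HSP-separates Xn Yn (proj₁ (same (𝔠-BF X)) (HSP-self (𝔠-BF X))))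
  ... | false | true  = ⊥-elim (HSP-separates Yn Xn (proj₂ (same (𝔠-BF Y)) (HSP-self (𝔠-BF Y))))

theorem2p9 : (lem : LEM) →
    ((X Y : Subset) → ¬ (∀ n → X n ≡ Y n) → ¬ SameClass (HSP (𝔠 lem X)) (HSP (𝔠 lem Y)))
    × ((X : Subset) → (∀ B → HSP (𝔠 lem X) B → Subadditive B)
                    × Σ BF (λ B → HSP (𝔠 lem X) B × ¬ CEP B))
theorem2p9 lem =
  (λ X Y X≢Y same → X≢Y (HSP-injective lem X Y same)) ,
  λ X → (λ B → HSP-subadditive lem X {B}) , (𝔠-BF X , HSP-self (𝔠-BF X) , ¬CEP X)
  where open Frame lem using (𝔠-BF; ¬CEP)
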